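{- Let $X=\mathrm{Cay}(\mathbb{Z}_2^n,S)$ be a Cayley graph, $G=\mathrm{Aut}(X)$, and $G_e$ the stabilizer in $G$ of the zero vector $e$. If $H$ is a subgroup with $G_e\le H\le G$, then $H=R(K)G_e$ for some subspace $K$ of $\mathbb{Z}_2^n$ that is closed under the action of $G_e$ (i.e. $k^g\in K$ for all $k\in K$, $g\in G_e$).
   Context: For $S\subseteq\mathbb{Z}_2^n\setminus\{0\}$, $\mathrm{Cay}(\mathbb{Z}_2^n,S)$ is the graph with vertex set $\mathbb{Z}_2^n$ in which $x,y$ are adjacent iff $x+y\in S$. Here $\mathbb{Z}_2^n$ is identified with $\mathbb{F}_2^n$. For $z\in\mathbb{Z}_2^n$, $\rho_z$ is the translation $x\mapsto x+z$ (an automorphism of $X$), and for $K\subseteq\mathbb{Z}_2^n$, $R(K)=\{\rho_z:z\in K\}$. -}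

module Defs where

open import Data.Bool using (Bool; false; _xor_)
open import Data.Nat using (ℕ)
open import Data.Vec using (Vec; zipWith; replicate)
open import Data.Product using (Σ; _×_; _,_; ∃)
open import Relation.Binary.PropositionalEquality using (_≡_)
open import Relation.Nullary using (¬_)
open import Function.Bundles using (_⇔_)

-- Z_2^n identified with F_2^n : bit vectors of length n
V : ℕ → Set
V n = Vec Bool n

_⊕_ : ∀ {n} → V n → V n → V n
_⊕_ = zipWith _xor_

𝟎 : ∀ {n} → V n
𝟎 {n} = replicate n false

ConnSet : ℕ → Set₁
ConnSet n = V n → Set

Adj : ∀ {n} → ConnSet n → V n → V n → Set
Adj S x y = S (x ⊕ y)

record Aut {n : ℕ} (S : ConnSet n) : Set where
  field
    fun     : V n → V n
    inv     : V n → V n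
    inv-l   : ∀ x → inv (fun x) ≡ x
    inv-r   : ∀ x → fun (inv x) ≡ x
    adj     : ∀ x y → Adj S x y ⇔ Adj S (fun x) (fun y)
open Aut public

_≈A_ : ∀ {n} {S : ConnSet n} → Aut S → Aut S → Set
σ ≈A τ = ∀ x → fun σ x ≡ fun τ x

InStab : ∀ {n} {S : ConnSet n} → Aut S → Set
InStab σ = fun σ 𝟎 ≡ 𝟎

record IsSubgroup {n : ℕ} {S : ConnSet n} (H : Aut S → Set) : Set where
  field
    resp   : ∀ σ τ → σ ≈A τ → H σ → H τ
    has-id : ∀ σ → (∀ x → fun σ x ≡ x) → H σ
    closed-∘ : ∀ σ τ ρ → (∀ x → fun ρ x ≡ fun τ (fun σ x)) → H σ → H τ → H ρ
    closed-inv : ∀ σ ρ → (∀ x → fun ρ x ≡ inv σ x) → H σ → H ρ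

record IsSubspace {n : ℕ} (K : V n → Set) : Set where
  field
    has-zero : K 𝟎
    closed-⊕ : ∀ x y → K x → K y → K (x ⊕ y)

GeClosed : ∀ {n} (S : ConnSet n) → (V n → Set) → Set
GeClosed S K = ∀ (g : Aut S) → InStab g → ∀ k → K k → K (fun g k)

-- σ ∈ R(K) G_e : σ = ρ_k g (x ↦ (x + k)^g) with k ∈ K, g ∈ G_e
InRKGe : ∀ {n} {S : ConnSet n} → (V n → Set) → Aut S → Set
InRKGe {n} {S} K σ =
  Σ (V n) λ k → K k × Σ (Aut S) λ g → InStab g × (∀ x → fun σ x ≡ fun g (x ⊕ k))

-- The subspace in the conclusion is the H-orbit of the zero vector,
--   K = { σ(0) : σ ∈ H }.
-- The proof rests on two factorisations that hold for every automorphism σ: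
--   * σ = g ∘ ρ_k with k = σ⁻¹(0) and g ∈ G_e            (stabilizer factorisation),
--   * ρ_k = σ ∘ g with k = σ(0)   and g = σ⁻¹ ∘ ρ_k ∈ G_e  (translation factorisation).
-- The second one shows that every translation ρ_k with k ∈ K lies in H, which
-- gives that K is closed under addition (ρ_x ∘ ρ_y = ρ_{x+y}) and the inclusion
-- R(K) G_e ⊆ H; the first one gives H ⊆ R(K) G_e, and K is G_e-closed since
-- g ∘ σ ∈ H whenever σ ∈ H.
module Submission where

open import Defs
open import Data.Nat using (ℕ)
open import Data.Product using (Σ; _×_)
open import Relation.Nullary using (¬_)
open import Function.Bundles using (_⇔_)

open import Data.Bool.Properties
  using (xor-assoc; xor-comm; xor-identityˡ; xor-identityʳ; xor-same)
open import Data.Product using (_,_)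
open import Data.Vec using (_∷_; [])
open import Data.Vec.Relation.Binary.Pointwise.Inductive
  using (Pointwise-≡⇒≡; zipWith-assoc; zipWith-comm; zipWith-identityˡ; zipWith-identityʳ)
open import Function.Bundles using (mk⇔)
import Function.Properties.Equivalence as ⇔
open import Relation.Binary.PropositionalEquality
  using (_≡_; refl; sym; trans; cong; cong₂; subst; subst₂; module ≡-Reasoning)

⊕-assoc : ∀ {n} (x y z : V n) → (x ⊕ y) ⊕ z ≡ x ⊕ (y ⊕ z)
⊕-assoc x y z = Pointwise-≡⇒≡ (zipWith-assoc xor-assoc x y z)

⊕-comm : ∀ {n} (x y : V n) → x ⊕ y ≡ y ⊕ x
⊕-comm x y = Pointwise-≡⇒≡ (zipWith-comm xor-comm x y)

⊕-identityˡ : ∀ {n} (x : V n) → 𝟎 ⊕ x ≡ x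
⊕-identityˡ x = Pointwise-≡⇒≡ (zipWith-identityˡ xor-identityˡ x)

⊕-identityʳ : ∀ {n} (x : V n) → x ⊕ 𝟎 ≡ x
⊕-identityʳ x = Pointwise-≡⇒≡ (zipWith-identityʳ xor-identityʳ x)

⊕-self : ∀ {n} (x : V n) → x ⊕ x ≡ 𝟎
⊕-self []      = refl
⊕-self (a ∷ x) = cong₂ _∷_ (xor-same a) (⊕-self x)

⊕-cancelʳ : ∀ {n} (x z : V n) → (x ⊕ z) ⊕ z ≡ x
⊕-cancelʳ x z = begin
  (x ⊕ z) ⊕ z  ≡⟨ ⊕-assoc x z z ⟩
  x ⊕ (z ⊕ z)  ≡⟨ cong (x ⊕_) (⊕-self z) ⟩
  x ⊕ 𝟎        ≡⟨ ⊕-identityʳ x ⟩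
  x            ∎
  where open ≡-Reasoning

⊕-translate : ∀ {n} (x y z : V n) → (x ⊕ z) ⊕ (y ⊕ z) ≡ x ⊕ y
⊕-translate x y z = begin
  (x ⊕ z) ⊕ (y ⊕ z)  ≡⟨ ⊕-assoc x z (y ⊕ z) ⟩
  x ⊕ (z ⊕ (y ⊕ z))  ≡⟨ cong (x ⊕_) (⊕-comm z (y ⊕ z)) ⟩
  x ⊕ ((y ⊕ z) ⊕ z)  ≡⟨ cong (x ⊕_) (⊕-cancelʳ y z) ⟩
  x ⊕ y              ∎
  where open ≡-Reasoning

module AutGroup {n : ℕ} {S : ConnSet n} where

  idA : Aut S
  idA = record
    { fun = λ x → x ; inv = λ x → x
    ; inv-l = λ _ → refl ; inv-r = λ _ → refl
    ; adj = λ _ _ → ⇔.refl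
    }

  -- τ ∘A σ is "first σ, then τ"
  infixr 9 _∘A_
  _∘A_ : Aut S → Aut S → Aut S
  τ ∘A σ = record
    { fun = λ x → fun τ (fun σ x)
    ; inv = λ x → inv σ (inv τ x)
    ; inv-l = λ x → trans (cong (inv σ) (inv-l τ (fun σ x))) (inv-l σ x)
    ; inv-r = λ x → trans (cong (fun τ) (inv-r σ (inv τ x))) (inv-r τ x)
    ; adj = λ x y → ⇔.trans (adj σ x y) (adj τ (fun σ x) (fun σ y))
    }

  infix 10 _⁻¹A
  _⁻¹A : Aut S → Aut S
  σ ⁻¹A = record
    { fun = inv σ ; inv = fun σ ; inv-l = inv-r σ ; inv-r = inv-l σ
    ; adj = λ x y →
        subst₂ (λ u v → Adj S u v ⇔ Adj S (inv σ x) (inv σ y))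
               (inv-r σ x) (inv-r σ y)
               (⇔.sym (adj σ (inv σ x) (inv σ y)))
    }

  ρ : V n → Aut S
  ρ z = record
    { fun = λ x → x ⊕ z ; inv = λ x → x ⊕ z
    ; inv-l = λ x → ⊕-cancelʳ x z ; inv-r = λ x → ⊕-cancelʳ x z
    ; adj = λ x y → subst (λ w → S (x ⊕ y) ⇔ S w) (sym (⊕-translate x y z)) ⇔.refl
    }

  stabilizer-factor : (σ : Aut S) →
    InStab (σ ∘A ρ (inv σ 𝟎)) × (∀ x → fun σ x ≡ fun (σ ∘A ρ (inv σ 𝟎)) (x ⊕ inv σ 𝟎))
  stabilizer-factor σ = fixes-𝟎 , factors
    where
    k : V n
    k = inv σ 𝟎
    fixes-𝟎 : fun σ (𝟎 ⊕ k) ≡ 𝟎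
    fixes-𝟎 = trans (cong (fun σ) (⊕-identityˡ k)) (inv-r σ 𝟎)
    factors : ∀ x → fun σ x ≡ fun σ ((x ⊕ k) ⊕ k)
    factors x = sym (cong (fun σ) (⊕-cancelʳ x k))

  translation-factor : (σ : Aut S) {k : V n} → fun σ 𝟎 ≡ k →
    InStab (σ ⁻¹A ∘A ρ k) × (∀ x → fun (ρ k) x ≡ fun σ (fun (σ ⁻¹A ∘A ρ k) x))
  translation-factor σ {k} σ𝟎≡k = fixes-𝟎 , factors
    where
    fixes-𝟎 : inv σ (𝟎 ⊕ k) ≡ 𝟎
    fixes-𝟎 = begin
      inv σ (𝟎 ⊕ k)    ≡⟨ cong (inv σ) (⊕-identityˡ k) ⟩
      inv σ k          ≡⟨ cong (inv σ) (sym σ𝟎≡k) ⟩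
      inv σ (fun σ 𝟎)  ≡⟨ inv-l σ 𝟎 ⟩
      𝟎                ∎
      where open ≡-Reasoning
    factors : ∀ x → x ⊕ k ≡ fun σ (inv σ (x ⊕ k))
    factors x = sym (inv-r σ (x ⊕ k))

module Overgroup {n : ℕ} {S : ConnSet n} (H : Aut S → Set) (H-subgroup : IsSubgroup H)
                 (Ge≤H : ∀ g → InStab g → H g) where
  open AutGroup
  open IsSubgroup H-subgroup

  ∘-closed : ∀ {σ τ} → H σ → H τ → H (τ ∘A σ)
  ∘-closed {σ} {τ} = closed-∘ σ τ (τ ∘A σ) (λ _ → refl)

  ⁻¹-closed : ∀ {σ} → H σ → H (σ ⁻¹A)
  ⁻¹-closed {σ} = closed-inv σ (σ ⁻¹A) (λ _ → refl)

  orbit : V n → Set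
  orbit k = Σ (Aut S) λ σ → H σ × fun σ 𝟎 ≡ k

  ρ∈H : ∀ k → orbit k → H (ρ k)
  ρ∈H k (σ , σ∈H , σ𝟎≡k) with translation-factor σ σ𝟎≡k
  ... | fixes-𝟎 , factors = closed-∘ (σ ⁻¹A ∘A ρ k) σ (ρ k) factors (Ge≤H (σ ⁻¹A ∘A ρ k) fixes-𝟎) σ∈H

  -- K is a subspace, since ρ_y ∘ ρ_x = ρ_{x+y}
  orbit-subspace : IsSubspace orbit
  orbit-subspace = record
    { has-zero = idA , has-id idA (λ _ → refl) , refl
    ; closed-⊕ = λ x y x∈K y∈K →
        ρ y ∘A ρ x , ∘-closed (ρ∈H x x∈K) (ρ∈H y y∈K) , cong (_⊕ y) (⊕-identityˡ x)
    }

  -- K is G_e-closed, since g ∘ σ ∈ H maps 0 to g(σ(0))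
  orbit-GeClosed : GeClosed S orbit
  orbit-GeClosed g g∈Ge k (σ , σ∈H , σ𝟎≡k) =
    g ∘A σ , ∘-closed σ∈H (Ge≤H g g∈Ge) , cong (fun g) σ𝟎≡k

  -- H ⊆ R(K) G_e, by the stabilizer factorisation with k = σ⁻¹(0) ∈ K
  H⊆RKGe : ∀ σ → H σ → InRKGe orbit σ
  H⊆RKGe σ σ∈H =
    inv σ 𝟎 , (σ ⁻¹A , ⁻¹-closed σ∈H , refl) , σ ∘A ρ (inv σ 𝟎) , stabilizer-factor σ

  RKGe⊆H : ∀ σ → InRKGe orbit σ → H σ
  RKGe⊆H σ (k , k∈K , g , g∈Ge , σ≡gρ) =
    closed-∘ (ρ k) g σ σ≡gρ (ρ∈H k k∈K) (Ge≤H g g∈Ge)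

mainTheorem10 : (n : ℕ) (S : ConnSet n) → ¬ S 𝟎 →
    (H : Aut S → Set) → IsSubgroup H → (∀ g → InStab g → H g) →
    Σ (V n → Set) λ K → IsSubspace K × GeClosed S K × (∀ σ → H σ ⇔ InRKGe K σ)
mainTheorem10 n S _ H H-subgroup Ge≤H =
  orbit , orbit-subspace , orbit-GeClosed , λ σ → mk⇔ (H⊆RKGe σ) (RKGe⊆H σ)
  where open Overgroup H H-subgroup Ge≤H
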